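{- For every prime power $q\ge 2$ and every positive integer $n$, \[ \log_2 {n \brack 1}_q \;\le\; A(n,q) \;\le\; (q-1)(n-1)+1, \] where ${n \brack 1}_q=\frac{q^n-1}{q-1}$.
   Context: Let $q$ be a prime power and $V$ an $n$-dimensional vector space over $\mathrm{GF}(q)$. An unknown $1$-dimensional subspace $\mathbf{v}$ of $V$ is to be found using queries that are subspaces $U$ of $V$; the answer to query $U$ is YES if $\mathbf{v}\le U$ and NO otherwise. $A(n,q)$ is the minimum number of queries needed, in the worst case, to determine $\mathbf{v}$ in adaptive search (later queries may depend on the answers to earlier ones). ${n\brack 1}_q$ is the number of $1$-dimensional subspaces of $V$. -}

module Defs where

open import Data.Nat using (ℕ; zero; suc; _^_; _∸_; _≤_; _⊔_)
open import Data.Nat.DivMod using (_/_)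
open import Data.Nat.Primality using (Prime)
open import Data.Fin using (Fin)
open import Data.Bool using (Bool; true; false; if_then_else_)
open import Data.Product using (Σ; ∃; _×_; _,_)
open import Data.Empty using (⊥)
open import Relation.Nullary using (¬_)
open import Relation.Binary.PropositionalEquality using (_≡_)
open import Algebra.Structures using (IsCommutativeRing)

IsPrimePower : ℕ → Set
IsPrimePower q = Σ ℕ λ p → Σ ℕ λ k → Prime p × 1 ≤ k × q ≡ p ^ k

record FieldOn (q : ℕ) : Set where
  infixl 6 _+_
  infixl 7 _*_
  field
    _+_ _*_ : Fin q → Fin q → Fin q
    -_      : Fin q → Fin q
    0# 1#   : Fin q
    isCommutativeRing : IsCommutativeRing _≡_ _+_ _*_ -_ 0# 1#
    0≢1     : ¬ (0# ≡ 1#)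
    inverse : ∀ x → ¬ (x ≡ 0#) → ∃ λ y → x * y ≡ 1#

module VectorSpace {q : ℕ} (F : FieldOn q) (n : ℕ) where
  open FieldOn F

  Vec : Set
  Vec = Fin n → Fin q

  zeroV : Vec
  zeroV _ = 0#

  _+V_ : Vec → Vec → Vec
  (x +V y) i = x i + y i

  _·_ : Fin q → Vec → Vec
  (c · x) i = c * x i

  NonZero : Vec → Set
  NonZero x = ¬ (∀ i → x i ≡ 0#)

  record Subspace : Set where
    field
      mem      : Vec → Bool
      mem-zero : mem zeroV ≡ true
      mem-+    : ∀ x y → mem x ≡ true → mem y ≡ true → mem (x +V y) ≡ true
      mem-·    : ∀ c x → mem x ≡ true → mem (c · x) ≡ true
  open Subspace public

  -- A 1-dimensional subspace, represented by a spanning (nonzero) vector.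
  record Line : Set where
    constructor line
    field
      gen     : Vec
      nonzero : NonZero gen
  open Line public

  SameLine : Line → Line → Set
  SameLine v w = ∃ λ c → (∀ i → gen w i ≡ (c · gen v) i)

  _≤S_ : Line → Subspace → Set
  v ≤S U = ∀ c → mem U (c · gen v) ≡ true

  -- Adaptive search strategies = binary decision trees:
  -- a node asks a subspace U and continues with the YES or NO subtree;
  -- a leaf announces a 1-dimensional subspace.
  data Tree : Set where
    leaf : Line → Tree
    node : Subspace → Tree → Tree → Tree

  depth : Tree → ℕ
  depth (leaf _)     = 0
  depth (node _ t f) = suc (depth t ⊔ depth f)

  Correct : Tree → Line → Set
  Correct (leaf w)     v = SameLine v w
  Correct (node U t f) v = (v ≤S U → Correct t v) × (¬ (v ≤S U) → Correct f v)

  Solves : Tree → Set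
  Solves t = ∀ v → Correct t v

gauss1 : ℕ → ℕ → ℕ
gauss1 n (suc (suc k)) = (suc (suc k) ^ n ∸ 1) / suc k
gauss1 n _ = 0

-- Lower bound: a strategy of depth d is a binary tree with at most 2^d leaves,
-- and distinct lines must reach distinct leaves. Counting the lines through
-- their normalised representatives (first non-zero coordinate equal to 1)
-- gives q^(n-1) + ... + q + 1 = [n 1]_q of them.
--
-- Upper bound: go through the coordinates asking "x_p = 0?". After the first
-- NO the line has a unique point with x_p = 1, and each coordinate x_j not yet
-- known to vanish is found with q - 1 queries "x_j = a x_p?" (the last value
-- needs no query). After the i-th pivot question at most n - i coordinates
-- remain, which gives the bound (q - 1)(n - 1) + 1.
module Submission where

open import Defs
open import Data.Nat using (ℕ; _^_; _≤_; _*_; _+_; _∸_)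
open import Data.Product using (Σ; _×_)

open import Level using (0ℓ)
open import Data.Nat using (zero; suc; _⊔_; z≤n; s≤s)
import Data.Nat.Properties as ℕₚ
open import Data.Nat.Properties
  using ( *-distribʳ-+; +-assoc; +-comm; +-suc; +-identityʳ; m+n∸n≡m; ≤-trans; ≤-reflexive
        ; +-mono-≤; ^-monoʳ-≤; m≤m⊔n; m≤n⊔m; ⊔-lub; m≤n+m; module ≤-Reasoning)
open import Data.Nat.DivMod using (_/_; m*n/n≡m)
open import Data.Fin as Fin using (Fin; combine; finToFun; funToFin)
open import Data.Fin.Properties using (¬Fin0; funToFin-finToFin; all?)
open import Data.Vec.Functional as VecF using (updateAt)
open import Data.Vec.Functional.Properties using (updateAt-updates; updateAt-minimal)
open import Data.Bool using (true)
import Data.Bool.Properties as Bool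
open import Data.Product using (_,_; proj₁; proj₂)
open import Data.List using (List; []; _∷_; _++_; map; length; filter; tabulate; allFin)
open import Data.List.Properties using (length-++; length-map; length-tabulate)
open import Data.List.Relation.Unary.All as All using (All; []; _∷_)
import Data.List.Relation.Unary.All.Properties as All
open import Data.List.Relation.Unary.AllPairs as AllPairs using (AllPairs; []; _∷_)
import Data.List.Relation.Unary.AllPairs.Properties as AllPairs
open import Data.List.Relation.Unary.Any as Any using (Any; here)
import Data.List.Relation.Unary.Unique.Propositional.Properties as Unique
open import Data.List.Membership.Propositional using (_∉_; lose)
open import Data.List.Membership.Propositional.Properties using (∈-allFin)
open import Function using (_∘_; const)
open import Relation.Nullary using (¬_; yes; no; does; contradiction)
open import Relation.Nullary.Decidable using (dec-true)
open import Relation.Unary using (Pred; Decidable; ∁)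
open import Relation.Unary.Properties using (∁?)
open import Relation.Binary.PropositionalEquality
open import Algebra.Bundles using (CommutativeRing)
open import Algebra.Structures using (IsCommutativeRing)

geometricSum : ℕ → ℕ → ℕ
geometricSum q zero    = 0
geometricSum q (suc m) = q ^ m + geometricSum q m

geometricSum-closedForm : ∀ k m →
  geometricSum (suc (suc k)) m * suc k + 1 ≡ suc (suc k) ^ m
geometricSum-closedForm k zero    = refl
geometricSum-closedForm k (suc m) = begin
  (X + S) * r + 1     ≡⟨ cong (_+ 1) (*-distribʳ-+ r X S) ⟩
  X * r + S * r + 1   ≡⟨ +-assoc (X * r) (S * r) 1 ⟩
  X * r + (S * r + 1) ≡⟨ cong (X * r +_) (geometricSum-closedForm k m) ⟩
  X * r + X           ≡⟨ +-comm (X * r) X ⟩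
  X + X * r           ≡⟨ cong (X +_) (ℕₚ.*-comm X r) ⟩
  suc r * X           ∎
  where
  open ≡-Reasoning
  r X S : ℕ
  r = suc k
  X = suc r ^ m
  S = geometricSum (suc r) m

gauss1≡geometricSum : ∀ k m → gauss1 m (suc (suc k)) ≡ geometricSum (suc (suc k)) m
gauss1≡geometricSum k m = begin
  (suc (suc k) ^ m ∸ 1) / suc k ≡⟨ cong (λ x → (x ∸ 1) / suc k) (sym (geometricSum-closedForm k m)) ⟩
  (S * suc k + 1 ∸ 1) / suc k   ≡⟨ cong (_/ suc k) (m+n∸n≡m (S * suc k) 1) ⟩
  (S * suc k) / suc k           ≡⟨ m*n/n≡m S (suc k) ⟩
  S                             ∎
  where
  open ≡-Reasoning
  S : ℕ
  S = geometricSum (suc (suc k)) m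

length≤filter+filter∁ : ∀ {a p} {A : Set a} {P : Pred A p} (P? : Decidable P) xs →
  length xs ≤ length (filter P? xs) + length (filter (∁? P?) xs)
length≤filter+filter∁ P? []       = z≤n
length≤filter+filter∁ P? (x ∷ xs) with P? x
... | yes _ = s≤s (length≤filter+filter∁ P? xs)
... | no  _ = ≤-trans (s≤s (length≤filter+filter∁ P? xs))
                      (≤-reflexive (sym (+-suc (length (filter P? xs)) _)))

funToFin-cong : ∀ {m n} {f g : Fin m → Fin n} → (∀ i → f i ≡ g i) → funToFin f ≡ funToFin g
funToFin-cong {zero}  f≗g = refl
funToFin-cong {suc m} f≗g = cong₂ combine (f≗g Fin.zero) (funToFin-cong (f≗g ∘ Fin.suc))

finToFun-injective : ∀ {m n} {i j : Fin (m ^ n)} →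
  (∀ x → finToFun {m} {n} i x ≡ finToFun j x) → i ≡ j
finToFun-injective {m} {n} {i} {j} eq =
  trans (sym (funToFin-finToFin {n} {m} i))
        (trans (funToFin-cong eq) (funToFin-finToFin {n} {m} j))

allFunctions : ∀ m n → List (Fin m → Fin n)
allFunctions m n = map (finToFun {n} {m}) (allFin (n ^ m))

allFunctions-distinct : ∀ m n → AllPairs (λ f g → ¬ (∀ x → f x ≡ g x)) (allFunctions m n)
allFunctions-distinct m n =
  AllPairs.map⁺ (AllPairs.map (λ i≢j → i≢j ∘ finToFun-injective) (Unique.allFin⁺ (n ^ m)))

length-allFunctions : ∀ m n → length (allFunctions m n) ≡ n ^ m
length-allFunctions m n =
  trans (length-map (finToFun {n} {m}) (allFin (n ^ m))) (length-tabulate {n = n ^ m} (λ i → i))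

¬FieldOn1 : ¬ FieldOn 1
¬FieldOn1 F with FieldOn.0# F | FieldOn.1# F | FieldOn.0≢1 F
... | Fin.zero | Fin.zero | 0≢1 = 0≢1 refl

module Projective {q : ℕ} (F : FieldOn q) where
  open FieldOn F renaming (_+_ to _+ᶠ_; _*_ to _*ᶠ_) public
  open IsCommutativeRing isCommutativeRing
    using (*-comm; *-assoc; *-identityˡ; *-identityʳ; zeroˡ; zeroʳ; distribˡ) public

  field-ring : CommutativeRing 0ℓ 0ℓ
  field-ring = record { isCommutativeRing = isCommutativeRing }

  open import Algebra.Properties.CommutativeSemigroup
    (CommutativeRing.*-commutativeSemigroup field-ring) using (x∙yz≈y∙xz; x∙yz≈z∙xy) public

  module V = VectorSpace F

  ≟-true⇒≡ : ∀ {x y : Fin q} → does (x Fin.≟ y) ≡ true → x ≡ y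
  ≟-true⇒≡ {x} {y} eq with x Fin.≟ y
  ... | yes x≡y = x≡y
  ≟-true⇒≡ () | no _

  module _ {n : ℕ} where
    open VectorSpace F n

    SameLine-sym : ∀ {v w} → SameLine v w → SameLine w v
    SameLine-sym {v} {w} (c , w≡cv) with inverse c c≢0
      where
      c≢0 : ¬ c ≡ 0#
      c≢0 c≡0 = nonzero w λ i → trans (w≡cv i) (trans (cong (_*ᶠ gen v i) c≡0) (zeroˡ _))
    ... | c⁻¹ , cc⁻¹≡1 = c⁻¹ , λ i → begin
      gen v i                ≡⟨ sym (*-identityˡ _) ⟩
      1# *ᶠ gen v i          ≡⟨ cong (_*ᶠ gen v i) (trans (sym cc⁻¹≡1) (*-comm c c⁻¹)) ⟩
      (c⁻¹ *ᶠ c) *ᶠ gen v i  ≡⟨ *-assoc c⁻¹ c (gen v i) ⟩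
      c⁻¹ *ᶠ (c *ᶠ gen v i)  ≡⟨ cong (c⁻¹ *ᶠ_) (sym (w≡cv i)) ⟩
      c⁻¹ *ᶠ gen w i         ∎
      where open ≡-Reasoning

    SameLine-trans : ∀ {u v w} → SameLine u v → SameLine v w → SameLine u w
    SameLine-trans {u} (c , v≡cu) (d , w≡dv) = d *ᶠ c , λ i →
      trans (w≡dv i) (trans (cong (d *ᶠ_) (v≡cu i)) (sym (*-assoc d c (gen u i))))

    ≤S-dec : ∀ U → Decidable (_≤S U)
    ≤S-dec U v = all? (λ c → mem U (c · gen v) Bool.≟ true)

    length≤2^depth : ∀ t {ls : List Line} → All (Correct t) ls →
      AllPairs (λ v w → ¬ SameLine v w) ls → length ls ≤ 2 ^ depth t
    length≤2^depth (leaf w) {[]}        _ _ = z≤n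
    length≤2^depth (leaf w) {_ ∷ []}    _ _ = s≤s z≤n
    length≤2^depth (leaf w) {u ∷ v ∷ _} (u≈w ∷ v≈w ∷ _) ((u≉v ∷ _) ∷ _) =
      contradiction (SameLine-trans {u} {w} {v} u≈w (SameLine-sym {v} {w} v≈w)) u≉v
    length≤2^depth (node U tyes tno) {ls} correct distinct = begin
      length ls                                      ≤⟨ length≤filter+filter∁ P? ls ⟩
      length (filter P? ls) + length (filter ¬P? ls) ≤⟨ +-mono-≤ inside outside ⟩
      2 ^ d + 2 ^ d                                  ≡⟨ cong (2 ^ d +_) (sym (+-identityʳ _)) ⟩
      2 ^ suc d                                      ∎
      where
      open ≤-Reasoning
      P? : Decidable (_≤S U)
      P? = ≤S-dec U
      ¬P? : Decidable (∁ (_≤S U))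
      ¬P? = ∁? P?
      d : ℕ
      d = depth tyes ⊔ depth tno
      inside : length (filter P? ls) ≤ 2 ^ d
      inside = ≤-trans
        (length≤2^depth tyes
          (All.zipWith (λ (c , p) → proj₁ c p) (All.filter⁺ P? correct , All.all-filter P? ls))
          (AllPairs.filter⁺ P? distinct))
        (^-monoʳ-≤ 2 (m≤m⊔n (depth tyes) (depth tno)))
      outside : length (filter ¬P? ls) ≤ 2 ^ d
      outside = ≤-trans
        (length≤2^depth tno
          (All.zipWith (λ (c , p) → proj₂ c p) (All.filter⁺ ¬P? correct , All.all-filter ¬P? ls))
          (AllPairs.filter⁺ ¬P? distinct))
        (^-monoʳ-≤ 2 (m≤n⊔m (depth tyes) (depth tno)))

    Ratio : Fin n → Fin n → Fin q → Subspace
    Ratio i j a = record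
      { mem      = λ x → does (x i Fin.≟ a *ᶠ x j)
      ; mem-zero = dec-true (_ Fin.≟ _) (sym (zeroʳ a))
      ; mem-+    = λ x y x∈ y∈ → dec-true (_ Fin.≟ _)
          (trans (cong₂ _+ᶠ_ (≟-true⇒≡ x∈) (≟-true⇒≡ y∈)) (sym (distribˡ a (x j) (y j))))
      ; mem-·    = λ c x x∈ → dec-true (_ Fin.≟ _)
          (trans (cong (c *ᶠ_) (≟-true⇒≡ x∈)) (x∙yz≈y∙xz c a (x j)))
      }

    ≤Ratio⇒ : ∀ v i j a → v ≤S Ratio i j a → gen v i ≡ a *ᶠ gen v j
    ≤Ratio⇒ v i j a v≤ = begin
      gen v i               ≡⟨ sym (*-identityˡ _) ⟩
      1# *ᶠ gen v i         ≡⟨ ≟-true⇒≡ (v≤ 1#) ⟩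
      a *ᶠ (1# *ᶠ gen v j)  ≡⟨ cong (a *ᶠ_) (*-identityˡ _) ⟩
      a *ᶠ gen v j          ∎
      where open ≡-Reasoning

    ⇒≤Ratio : ∀ v i j a → gen v i ≡ a *ᶠ gen v j → v ≤S Ratio i j a
    ⇒≤Ratio v i j a eq c = dec-true (_ Fin.≟ _)
      (trans (cong (c *ᶠ_) eq) (x∙yz≈y∙xz c a (gen v j)))

  lead1 : ∀ {m} → (Fin m → Fin q) → V.Line (suc m)
  lead1 x = V.line (1# VecF.∷ x) λ x≡0 → 0≢1 (sym (x≡0 Fin.zero))

  lead0 : ∀ {m} → V.Line m → V.Line (suc m)
  lead0 w = V.line (0# VecF.∷ V.gen w) λ x≡0 → V.nonzero w (x≡0 ∘ Fin.suc)

  lead1-injective : ∀ {m} {x y : Fin m → Fin q} →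
    V.SameLine (suc m) (lead1 x) (lead1 y) → ∀ i → x i ≡ y i
  lead1-injective {x = x} (c , eq) i = sym (begin
    _            ≡⟨ eq (Fin.suc i) ⟩
    c *ᶠ x i     ≡⟨ cong (_*ᶠ x i) c≡1 ⟩
    1# *ᶠ x i    ≡⟨ *-identityˡ (x i) ⟩
    x i          ∎)
    where
    open ≡-Reasoning
    c≡1 : c ≡ 1#
    c≡1 = trans (sym (*-identityʳ c)) (sym (eq Fin.zero))

  lead0-cancel : ∀ {m} {v w : V.Line m} → V.SameLine (suc m) (lead0 v) (lead0 w) → V.SameLine m v w
  lead0-cancel (c , eq) = c , eq ∘ Fin.suc

  lead1≉lead0 : ∀ {m} {x : Fin m → Fin q} {w : V.Line m} → ¬ V.SameLine (suc m) (lead1 x) (lead0 w)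
  lead1≉lead0 {x = x} {w} (c , eq) = V.nonzero w λ i → begin
    V.gen w i  ≡⟨ eq (Fin.suc i) ⟩
    c *ᶠ x i   ≡⟨ cong (_*ᶠ x i) c≡0 ⟩
    0# *ᶠ x i  ≡⟨ zeroˡ (x i) ⟩
    0#         ∎
    where
    open ≡-Reasoning
    c≡0 : c ≡ 0#
    c≡0 = trans (sym (*-identityʳ c)) (sym (eq Fin.zero))

  normalLines : ∀ m → List (V.Line m)
  normalLines zero    = []
  normalLines (suc m) = map lead1 (allFunctions m q) ++ map lead0 (normalLines m)

  normalLines-distinct : ∀ m → AllPairs (λ v w → ¬ V.SameLine m v w) (normalLines m)
  normalLines-distinct zero    = []
  normalLines-distinct (suc m) = AllPairs.++⁺
    (AllPairs.map⁺ (AllPairs.map (λ x≢y → x≢y ∘ lead1-injective) (allFunctions-distinct m q)))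
    (AllPairs.map⁺ (AllPairs.map (λ {v} {w} v≉w → v≉w ∘ lead0-cancel {v = v} {w})
                                 (normalLines-distinct m)))
    (All.map⁺ (All.universal
      (λ x → All.map⁺ (All.universal (λ w → lead1≉lead0 {x = x} {w}) (normalLines m)))
      (allFunctions m q)))

  length-normalLines : ∀ m → length (normalLines m) ≡ geometricSum q m
  length-normalLines zero    = refl
  length-normalLines (suc m) = begin
    length (map lead1 (allFunctions m q) ++ map lead0 (normalLines m))
      ≡⟨ length-++ (map lead1 (allFunctions m q)) ⟩
    length (map lead1 (allFunctions m q)) + length (map lead0 (normalLines m))
      ≡⟨ cong₂ _+_ (trans (length-map lead1 (allFunctions m q)) (length-allFunctions m q))
                   (trans (length-map lead0 (normalLines m)) (length-normalLines m)) ⟩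
    q ^ m + geometricSum q m
      ∎
    where open ≡-Reasoning

  lowerBound : ∀ n (t : V.Tree n) → V.Solves n t → geometricSum q n ≤ 2 ^ V.depth n t
  lowerBound n t solves = subst (_≤ 2 ^ V.depth n t) (length-normalLines n)
    (length≤2^depth t (All.universal solves (normalLines n)) (normalLines-distinct n))

module Strategy {k : ℕ} (F : FieldOn (suc (suc k))) (n : ℕ) where
  open Projective F
  open VectorSpace F n

  scan : ∀ {A : Set} → A → List A → (A → Subspace) → (A → Tree) → Tree
  scan a []       Q next = next a
  scan a (b ∷ bs) Q next = node (Q a) (next a) (scan b bs Q next)

  scanField : (Fin (suc (suc k)) → Subspace) → (Fin (suc (suc k)) → Tree) → Tree
  scanField = scan Fin.zero (tabulate Fin.suc)

  -- acc j records the ratio x_j / x_p found so far; the leaf normalises x_p to 1.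
  determine : Fin n → List (Fin n) → (Fin n → Fin (suc (suc k))) → Tree
  determine p []       acc = leaf (line (updateAt acc p (const 1#))
    λ x≡0 → 0≢1 (trans (sym (x≡0 p)) (updateAt-updates p acc)))
  determine p (j ∷ js) acc =
    scanField (Ratio j p) (λ a → determine p js (updateAt acc j (const a)))

  -- Ratio p p 0# is the hyperplane x_p = 0.
  pivotSearch : Fin n → List (Fin n) → Tree
  pivotSearch p []       = determine p [] zeroV
  pivotSearch p (j ∷ js) = node (Ratio p p 0#) (pivotSearch j js) (determine p (j ∷ js) zeroV)

  scan-depth : ∀ {A : Set} a (as : List A) Q next d → (∀ b → depth (next b) ≤ d) →
    depth (scan a as Q next) ≤ length as + d
  scan-depth a []       Q next d bounded = bounded a
  scan-depth a (b ∷ bs) Q next d bounded = s≤s (⊔-lub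
    (≤-trans (bounded a) (m≤n+m d (length bs)))
    (scan-depth b bs Q next d bounded))

  scanField-depth : ∀ Q next d → (∀ b → depth (next b) ≤ d) →
    depth (scanField Q next) ≤ suc k + d
  scanField-depth Q next d bounded =
    subst (λ l → depth (scanField Q next) ≤ l + d) (length-tabulate Fin.suc)
      (scan-depth Fin.zero (tabulate Fin.suc) Q next d bounded)

  determine-depth : ∀ p js acc → depth (determine p js acc) ≤ length js * suc k
  determine-depth p []       acc = z≤n
  determine-depth p (j ∷ js) acc = scanField-depth _ _ (length js * suc k)
    λ a → determine-depth p js (updateAt acc j (const a))

  pivotSearch-depth : ∀ p js → depth (pivotSearch p js) ≤ suc (length js * suc k)
  pivotSearch-depth p []       = z≤n
  pivotSearch-depth p (j ∷ js) = s≤s (⊔-lub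
    (≤-trans (pivotSearch-depth j js) (s≤s (m≤n+m (length js * suc k) k)))
    (determine-depth p (j ∷ js) zeroV))

  module _ (v : Line) where

    scan-correct : ∀ {A : Set} a (as : List A) Q next →
      (∀ b → v ≤S Q b → Correct (next b) v) →
      Any (λ b → v ≤S Q b) (a ∷ as) → Correct (scan a as Q next) v
    scan-correct a []       Q next ok (here v≤Qa) = ok a v≤Qa
    scan-correct a (b ∷ bs) Q next ok found =
      ok a , λ v≰Qa → scan-correct b bs Q next ok (Any.tail v≰Qa found)

    scanField-correct : ∀ Q next → (∀ b → v ≤S Q b → Correct (next b) v) →
      ∀ b → v ≤S Q b → Correct (scanField Q next) v
    scanField-correct Q next ok b v≤Qb =
      scan-correct Fin.zero (tabulate Fin.suc) Q next ok (lose (∈-allFin b) v≤Qb)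

    determine-correct : ∀ p js acc → ¬ gen v p ≡ 0# →
      (∀ i → ¬ i ≡ p → i ∉ js → gen v i ≡ acc i *ᶠ gen v p) →
      Correct (determine p js acc) v
    determine-correct p [] acc vp≢0 known with inverse (gen v p) vp≢0
    ... | c , vpc≡1 = c , normalised
      where
      normalised : ∀ i → updateAt acc p (const 1#) i ≡ c *ᶠ gen v i
      normalised i with i Fin.≟ p
      ... | yes refl = trans (updateAt-updates p acc) (trans (sym vpc≡1) (*-comm (gen v p) c))
      ... | no i≢p = begin
        updateAt acc p (const 1#) i  ≡⟨ updateAt-minimal i p acc i≢p ⟩
        acc i                        ≡⟨ sym (*-identityʳ (acc i)) ⟩
        acc i *ᶠ 1#                  ≡⟨ cong (acc i *ᶠ_) (sym vpc≡1) ⟩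
        acc i *ᶠ (gen v p *ᶠ c)      ≡⟨ x∙yz≈z∙xy (acc i) (gen v p) c ⟩
        c *ᶠ (acc i *ᶠ gen v p)      ≡⟨ cong (c *ᶠ_) (sym (known i i≢p λ ())) ⟩
        c *ᶠ gen v i                 ∎
        where open ≡-Reasoning
    determine-correct p (j ∷ js) acc vp≢0 known with inverse (gen v p) vp≢0
    ... | c , vpc≡1 =
      scanField-correct (Ratio j p) _ next-correct (gen v j *ᶠ c) (⇒≤Ratio v j p _ vj≡ratio)
      where
      vj≡ratio : gen v j ≡ (gen v j *ᶠ c) *ᶠ gen v p
      vj≡ratio = begin
        gen v j                    ≡⟨ sym (*-identityʳ (gen v j)) ⟩
        gen v j *ᶠ 1#              ≡⟨ cong (gen v j *ᶠ_) (trans (sym vpc≡1) (*-comm (gen v p) c)) ⟩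
        gen v j *ᶠ (c *ᶠ gen v p)  ≡⟨ sym (*-assoc (gen v j) c (gen v p)) ⟩
        (gen v j *ᶠ c) *ᶠ gen v p  ∎
        where open ≡-Reasoning
      next-correct : ∀ a → v ≤S Ratio j p a →
        Correct (determine p js (updateAt acc j (const a))) v
      next-correct a v≤ = determine-correct p js _ vp≢0 known′
        where
        known′ : ∀ i → ¬ i ≡ p → i ∉ js → gen v i ≡ updateAt acc j (const a) i *ᶠ gen v p
        known′ i i≢p i∉js with i Fin.≟ j
        ... | yes refl = trans (≤Ratio⇒ v j p a v≤)
                               (cong (_*ᶠ gen v p) (sym (updateAt-updates j acc)))
        ... | no i≢j   = trans (known i i≢p (i∉js ∘ Any.tail i≢j))
                               (cong (_*ᶠ gen v p) (sym (updateAt-minimal i j acc i≢j)))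

    determine-pivot : ∀ p js → ¬ gen v p ≡ 0# → (∀ i → i ∉ p ∷ js → gen v i ≡ 0#) →
      Correct (determine p js zeroV) v
    determine-pivot p js vp≢0 outside≡0 = determine-correct p js zeroV vp≢0
      λ i i≢p i∉js → trans (outside≡0 i (i∉js ∘ Any.tail i≢p)) (sym (zeroˡ (gen v p)))

    vanishing-outside-tail : ∀ p js → gen v p ≡ 0# →
      (∀ i → i ∉ p ∷ js → gen v i ≡ 0#) → ∀ i → i ∉ js → gen v i ≡ 0#
    vanishing-outside-tail p js vp≡0 outside≡0 i i∉js with i Fin.≟ p
    ... | yes refl = vp≡0
    ... | no i≢p   = outside≡0 i (i∉js ∘ Any.tail i≢p)

    pivotSearch-correct : ∀ p js → (∀ i → i ∉ p ∷ js → gen v i ≡ 0#) →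
      Correct (pivotSearch p js) v
    pivotSearch-correct p [] outside≡0 = determine-pivot p [] vp≢0 outside≡0
      where
      vp≢0 : ¬ gen v p ≡ 0#
      vp≢0 vp≡0 = nonzero v λ i → vanishing-outside-tail p [] vp≡0 outside≡0 i λ ()
    pivotSearch-correct p (j ∷ js) outside≡0 = inside , outside
      where
      inside : v ≤S Ratio p p 0# → Correct (pivotSearch j js) v
      inside v≤ = pivotSearch-correct j js (vanishing-outside-tail p (j ∷ js)
        (trans (≤Ratio⇒ v p p 0# v≤) (zeroˡ (gen v p))) outside≡0)
      outside : ¬ v ≤S Ratio p p 0# → Correct (determine p (j ∷ js) zeroV) v
      outside v≰ = determine-pivot p (j ∷ js)
        (λ vp≡0 → v≰ (⇒≤Ratio v p p 0# (trans vp≡0 (sym (zeroˡ (gen v p)))))) outside≡0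

upperBound : ∀ {k} (F : FieldOn (suc (suc k))) m →
  Σ (VectorSpace.Tree F (suc m)) λ t →
    VectorSpace.Solves F (suc m) t × VectorSpace.depth F (suc m) t ≤ suc (m * suc k)
upperBound {k} F m =
  pivotSearch Fin.zero coordinates ,
  (λ v → pivotSearch-correct v Fin.zero coordinates λ i i∉ → contradiction (∈-allFin i) i∉) ,
  subst (λ l → depth (pivotSearch Fin.zero coordinates) ≤ suc (l * suc k))
        (length-tabulate {n = m} Fin.suc) (pivotSearch-depth Fin.zero coordinates)
  where
  open VectorSpace F (suc m)
  open Strategy F (suc m)
  coordinates : List (Fin (suc m))
  coordinates = tabulate Fin.suc

theorem1p3 : ∀ (q : ℕ) → IsPrimePower q → (F : FieldOn q) → ∀ (n : ℕ) → 1 ≤ n →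
    ((t : VectorSpace.Tree F n) → VectorSpace.Solves F n t →
    gauss1 n q ≤ 2 ^ VectorSpace.depth F n t)
    × Σ (VectorSpace.Tree F n) (λ t → VectorSpace.Solves F n t ×
    VectorSpace.depth F n t ≤ (q ∸ 1) * (n ∸ 1) + 1)
theorem1p3 zero          _ F = contradiction (FieldOn.0# F) ¬Fin0
theorem1p3 (suc zero)    _ F = contradiction F ¬FieldOn1
theorem1p3 (suc (suc k)) _ F zero ()
theorem1p3 (suc (suc k)) _ F (suc m) _ = lower , upper
  where
  lower : (t : VectorSpace.Tree F (suc m)) → VectorSpace.Solves F (suc m) t →
    gauss1 (suc m) (suc (suc k)) ≤ 2 ^ VectorSpace.depth F (suc m) t
  lower t solves = subst (_≤ 2 ^ VectorSpace.depth F (suc m) t)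
    (sym (gauss1≡geometricSum k (suc m))) (Projective.lowerBound F (suc m) t solves)
  upper : Σ (VectorSpace.Tree F (suc m)) λ t → VectorSpace.Solves F (suc m) t ×
    VectorSpace.depth F (suc m) t ≤ suc k * m + 1
  upper = let t , solves , depth≤ = upperBound F m in
    t , solves , ≤-trans depth≤
      (≤-reflexive (trans (cong suc (ℕₚ.*-comm m (suc k))) (+-comm 1 (suc k * m))))
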